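{- Let $A=(x_1,x_2,x_3,x_4)\in\mathbb{Z}^4$ with $A\neq O=(0,0,0,0)$, and suppose $x_1^2+x_2^2+x_3^2+x_4^2$ is even. Then there exists $B\in\mathbb{Z}^4$ such that $OAB$ is an equilateral triangle. Moreover, there exists $C\in\mathbb{Z}^4$ such that $OABC$ is a regular tetrahedron (all six pairwise distances among $O,A,B,C$ are equal).
   Context: An equilateral triangle $OAB$ means the three Euclidean distances $|OA|,|OB|,|AB|$ are equal and positive. -}

module Defs where

open import Data.Integer using (ℤ; _+_; _-_; _*_; _<_; +_; 0ℤ)
open import Data.Product using (_×_; _,_)
open import Relation.Binary.PropositionalEquality using (_≡_)

Point : Set
Point = ℤ × ℤ × ℤ × ℤ

origin : Point
origin = (0ℤ , 0ℤ , 0ℤ , 0ℤ)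

sq : ℤ → ℤ
sq x = x * x

normSq : Point → ℤ
normSq (a , b , c , d) = sq a + sq b + sq c + sq d

distSq : Point → Point → ℤ
distSq (a , b , c , d) (a' , b' , c' , d') =
  sq (a - a') + sq (b - b') + sq (c - c') + sq (d - d')

-- Euclidean distances are nonnegative square roots of the squared
-- distances, so equality/positivity of distances is equivalent to
-- equality/positivity of the squared distances.
Equilateral : Point → Point → Point → Set
Equilateral P Q R =
  (+ 0 < distSq P Q) × (distSq P Q ≡ distSq P R) × (distSq P Q ≡ distSq Q R)

RegularTetrahedron : Point → Point → Point → Point → Set
RegularTetrahedron P Q R S =
  (+ 0 < distSq P Q) ×
  (distSq P Q ≡ distSq P R) × (distSq P Q ≡ distSq P S) ×
  (distSq P Q ≡ distSq Q R) × (distSq P Q ≡ distSq Q S) ×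
  (distSq P Q ≡ distSq R S)

module Submission where

-- Write A = (a , b , c , d).  Since x² − x is always even, the
-- hypothesis 2 ∣ |A|² says that a + b + c + d = 2m for some integer m, i.e.
-- d = 2m − a − b − c.  For such a point the two integer points
--   B = (a − m , a + b + c − m , m − b , m − c)
--   C = (m − b − c , a + b − m , m , m − a − c)
-- satisfy |OB|² = |OC|² = |AB|² = |AC|² = |BC|² = |OA|² identically in
-- a, b, c, m.  (For instance B is obtained from A − m(1,1,1,1), the
-- reflection of A in the hyperplane orthogonal to (1,1,1,1), by a signed
-- permutation of coordinates, so |OB| = |OA|.)
-- So OABC is a regular tetrahedron as soon as A ≠ O, and its face OAB is
-- equilateral.

open import Defs
open import Data.Integer using (ℤ; +_; _+_; _-_; _*_; _<_; _≤_; 0ℤ; +0; +[1+_]; -[1+_]; +≤+; +<+; _≟_)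
open import Data.Integer.Properties using (+-mono-<-≤; +-mono-≤-<; +-mono-≤)
open import Data.Integer.DivMod using (_%ℕ_; _/ℕ_; n%ℕd<d; a≡a%ℕn+[a/ℕn]*n)
open import Data.Integer.Divisibility using (_∣_)
open import Data.Integer.Divisibility.Signed using (divides; quotient; ∣ᵤ⇒∣; ∣m∣n⇒∣m+n; ∣m+n∣m⇒∣n)
  renaming (_∣_ to _∣ₛ_)
open import Data.Integer.Solver using (module +-*-Solver)
open import Data.Integer.Tactic.RingSolver using (solve-∀)
open import Data.Nat using (suc; s≤s; z≤n)
open import Data.Product using (_×_; Σ; _,_)
open import Data.Empty using (⊥-elim)
open import Function using (_∘_)
open import Relation.Binary.PropositionalEquality using (_≡_; _≢_; refl; sym; trans; cong; subst; module ≡-Reasoning)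
open import Relation.Nullary using (¬_; yes; no)

open +-*-Solver using (solve; _:=_; _:+_; _:-_; _:*_; con; Polynomial)

-- Instantiated at ℤ they compute exactly distSq,
-- normSq and the points of the idea above; instantiated at the ring
-- solver's polynomial syntax they let the solver verify identities
-- between these very expressions.
module Formulas {R : Set} (zero : R) (plus minus times : R → R → R) where
  infixl 6 _⊕_ _⊖_
  infixl 7 _⊛_
  _⊕_ _⊖_ _⊛_ : R → R → R
  _⊕_ = plus
  _⊖_ = minus
  _⊛_ = times

  Quadruple : Set
  Quadruple = R × R × R × R

  O : Quadruple
  O = (zero , zero , zero , zero)

  norm : Quadruple → R
  norm (a , b , c , d) = a ⊛ a ⊕ b ⊛ b ⊕ c ⊛ c ⊕ d ⊛ d

  dist : Quadruple → Quadruple → R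
  dist (a , b , c , d) (a' , b' , c' , d') =
    (a ⊖ a') ⊛ (a ⊖ a') ⊕ (b ⊖ b') ⊛ (b ⊖ b') ⊕ (c ⊖ c') ⊛ (c ⊖ c') ⊕ (d ⊖ d') ⊛ (d ⊖ d')

  vertexA vertexB vertexC : R → R → R → R → Quadruple
  vertexA a b c m = (a , b , c , m ⊕ m ⊖ a ⊖ b ⊖ c)
  vertexB a b c m = (a ⊖ m , a ⊕ b ⊕ c ⊖ m , m ⊖ b , m ⊖ c)
  vertexC a b c m = (m ⊖ b ⊖ c , a ⊕ b ⊖ m , m , m ⊖ a ⊖ c)

open Formulas 0ℤ _+_ _-_ _*_ using (vertexA; vertexB; vertexC)
module Poly = Formulas {Polynomial 4} (con 0ℤ) _:+_ _:-_ _:*_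

distSq-origin : ∀ P → distSq origin P ≡ normSq P
distSq-origin (a , b , c , d) = expand a b c d
  where
  expand : ∀ a b c d → distSq origin (a , b , c , d) ≡ normSq (a , b , c , d)
  expand = solve 4 (λ a b c d → Poly.dist Poly.O (a , b , c , d) :=
                                Poly.norm (a , b , c , d)) refl

regular-tetrahedron : ∀ a b c m → + 0 < distSq origin (vertexA a b c m) →
  RegularTetrahedron origin (vertexA a b c m) (vertexB a b c m) (vertexC a b c m)
regular-tetrahedron a b c m OA>0 =
  OA>0 , OA=OB a b c m , OA=OC a b c m , OA=AB a b c m , OA=AC a b c m , OA=BC a b c m
  where
  OA=OB : ∀ a b c m → distSq origin (vertexA a b c m) ≡ distSq origin (vertexB a b c m)
  OA=OB = solve 4 (λ a b c m → Poly.dist Poly.O (Poly.vertexA a b c m) :=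
                              Poly.dist Poly.O (Poly.vertexB a b c m)) refl
  OA=OC : ∀ a b c m → distSq origin (vertexA a b c m) ≡ distSq origin (vertexC a b c m)
  OA=OC = solve 4 (λ a b c m → Poly.dist Poly.O (Poly.vertexA a b c m) :=
                              Poly.dist Poly.O (Poly.vertexC a b c m)) refl
  OA=AB : ∀ a b c m → distSq origin (vertexA a b c m) ≡ distSq (vertexA a b c m) (vertexB a b c m)
  OA=AB = solve 4 (λ a b c m → Poly.dist Poly.O (Poly.vertexA a b c m) :=
                              Poly.dist (Poly.vertexA a b c m) (Poly.vertexB a b c m)) refl
  OA=AC : ∀ a b c m → distSq origin (vertexA a b c m) ≡ distSq (vertexA a b c m) (vertexC a b c m)
  OA=AC = solve 4 (λ a b c m → Poly.dist Poly.O (Poly.vertexA a b c m) :=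
                              Poly.dist (Poly.vertexA a b c m) (Poly.vertexC a b c m)) refl
  OA=BC : ∀ a b c m → distSq origin (vertexA a b c m) ≡ distSq (vertexB a b c m) (vertexC a b c m)
  OA=BC = solve 4 (λ a b c m → Poly.dist Poly.O (Poly.vertexA a b c m) :=
                              Poly.dist (Poly.vertexB a b c m) (Poly.vertexC a b c m)) refl

tetrahedron-face : ∀ P Q R S → RegularTetrahedron P Q R S → Equilateral P Q R
tetrahedron-face _ _ _ _ (PQ>0 , PQ=PR , _ , PQ=QR , _) = PQ>0 , PQ=PR , PQ=QR

sq-nonneg : ∀ x → 0ℤ ≤ x * x
sq-nonneg +0       = +≤+ z≤n
sq-nonneg +[1+ n ] = +≤+ z≤n
sq-nonneg -[1+ n ] = +≤+ z≤n

sq-pos : ∀ x → x ≢ 0ℤ → 0ℤ < x * x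
sq-pos +0       x≢0 = ⊥-elim (x≢0 refl)
sq-pos +[1+ n ] _   = +<+ (s≤s z≤n)
sq-pos -[1+ n ] _   = +<+ (s≤s z≤n)

normSq-pos : ∀ P → P ≢ origin → 0ℤ < normSq P
normSq-pos (a , b , c , d) P≢O with a ≟ 0ℤ | b ≟ 0ℤ | c ≟ 0ℤ | d ≟ 0ℤ
... | no a≢0 | _ | _ | _ =
  +-mono-<-≤ (+-mono-<-≤ (+-mono-<-≤ (sq-pos a a≢0) (sq-nonneg b)) (sq-nonneg c)) (sq-nonneg d)
... | yes refl | no b≢0 | _ | _ =
  +-mono-<-≤ (+-mono-<-≤ (+-mono-≤-< (sq-nonneg a) (sq-pos b b≢0)) (sq-nonneg c)) (sq-nonneg d)
... | yes refl | yes refl | no c≢0 | _ =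
  +-mono-<-≤ (+-mono-≤-< (+-mono-≤ (sq-nonneg a) (sq-nonneg b)) (sq-pos c c≢0)) (sq-nonneg d)
... | yes refl | yes refl | yes refl | no d≢0 =
  +-mono-≤-< (+-mono-≤ (+-mono-≤ (sq-nonneg a) (sq-nonneg b)) (sq-nonneg c)) (sq-pos d d≢0)
... | yes refl | yes refl | yes refl | yes refl = ⊥-elim (P≢O refl)

-- x² − x = x(x − 1) is even: split x = r + 2q with r ∈ {0, 1}.
sq-minus-self-even : ∀ x → + 2 ∣ₛ x * x - x
sq-minus-self-even x with x %ℕ 2 | n%ℕd<d x 2 | a≡a%ℕn+[a/ℕn]*n x 2
... | 0 | _ | x≡2q = divides (q * q * + 2 - q) (trans (cong (λ y → y * y - y) x≡2q) (even-case q))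
  where
  q : ℤ
  q = x /ℕ 2
  even-case : ∀ k → (+ 0 + k * + 2) * (+ 0 + k * + 2) - (+ 0 + k * + 2) ≡ (k * k * + 2 - k) * + 2
  even-case = solve-∀
... | 1 | _ | x≡1+2q = divides (q * q * + 2 + q) (trans (cong (λ y → y * y - y) x≡1+2q) (odd-case q))
  where
  q : ℤ
  q = x /ℕ 2
  odd-case : ∀ k → (+ 1 + k * + 2) * (+ 1 + k * + 2) - (+ 1 + k * + 2) ≡ (k * k * + 2 + k) * + 2
  odd-case = solve-∀
... | suc (suc _) | s≤s (s≤s ()) | _

coordinate-sum-even : ∀ a b c d → + 2 ∣ₛ normSq (a , b , c , d) → + 2 ∣ₛ a + b + c + d
coordinate-sum-even a b c d 2∣normSq =
  ∣m+n∣m⇒∣n (subst (+ 2 ∣ₛ_) (sym (split a b c d)) 2∣normSq)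
    (∣m∣n⇒∣m+n (∣m∣n⇒∣m+n (∣m∣n⇒∣m+n (sq-minus-self-even a) (sq-minus-self-even b))
      (sq-minus-self-even c)) (sq-minus-self-even d))
  where
  split : ∀ a b c d → (a * a - a) + (b * b - b) + (c * c - c) + (d * d - d) + (a + b + c + d)
                      ≡ a * a + b * b + c * c + d * d
  split = solve-∀

even-sum-point : ∀ a b c d → (2∣sum : + 2 ∣ₛ a + b + c + d) →
  (a , b , c , d) ≡ vertexA a b c (quotient 2∣sum)
even-sum-point a b c d (divides m sum≡2m) = cong (λ x → (a , b , c , x)) (begin
  d                         ≡⟨ isolate a b c d ⟩
  a + b + c + d - a - b - c ≡⟨ cong (λ s → s - a - b - c) sum≡2m ⟩
  m * + 2 - a - b - c       ≡⟨ double m a b c ⟩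
  m + m - a - b - c         ∎)
  where
  open ≡-Reasoning
  isolate : ∀ a b c d → d ≡ a + b + c + d - a - b - c
  isolate = solve-∀
  double : ∀ m a b c → m * + 2 - a - b - c ≡ m + m - a - b - c
  double = solve-∀

Extends : Point → Set
Extends A = Σ Point (λ B → Equilateral origin A B × Σ Point (λ C → RegularTetrahedron origin A B C))

tetrahedron-on : ∀ a b c m → vertexA a b c m ≢ origin → Extends (vertexA a b c m)
tetrahedron-on a b c m A≢O = B , tetrahedron-face origin A B C OABC , C , OABC
  where
  A B C : Point
  A = vertexA a b c m
  B = vertexB a b c m
  C = vertexC a b c m
  OA>0 : + 0 < distSq origin A
  OA>0 = subst (+ 0 <_) (sym (distSq-origin A)) (normSq-pos A A≢O)
  OABC : RegularTetrahedron origin A B C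
  OABC = regular-tetrahedron a b c m OA>0

proposition2p3 : (A : Point) → ¬ (A ≡ origin) → (+ 2) ∣ normSq A →
    Σ Point (λ B → Equilateral origin A B ×
      Σ Point (λ C → RegularTetrahedron origin A B C))
proposition2p3 (a , b , c , d) A≢O 2∣normSq =
  subst Extends (sym A≡vertexA) (tetrahedron-on a b c (quotient 2∣sum) (A≢O ∘ trans A≡vertexA))
  where
  -- the implicit arguments are given so that normSq is not unfolded
  2∣sum : + 2 ∣ₛ a + b + c + d
  2∣sum = coordinate-sum-even a b c d (∣ᵤ⇒∣ {+ 2} {normSq (a , b , c , d)} 2∣normSq)
  A≡vertexA : (a , b , c , d) ≡ vertexA a b c (quotient 2∣sum)
  A≡vertexA = even-sum-point a b c d 2∣sum
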